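{- Let $G$ be a finite, connected, undirected multigraph without loops, let $x\neq y$ be vertices, and let $k_{xy}$ be an integer with $\gcd(|\mathrm{Jac}(G)|,k_{xy})=1$. Let $G_1$ be the multigraph obtained from $G$ by deleting $k_{xy}$ of the edges between $x$ and $y$ if $k_{xy}\ge 0$ (assuming $G$ has at least $k_{xy}$ such edges), or by adding $|k_{xy}|$ edges between $x$ and $y$ if $k_{xy}<0$; assume $G_1$ is connected. Let $S$ be the subgroup of $\mathrm{Jac}(G)$ generated by $[\delta_{xy}]$ and $S_1$ the subgroup of $\mathrm{Jac}(G_1)$ generated by $[\delta_{xy}]$. Then $$\gcd(|\mathrm{Jac}(G)|,|\mathrm{Jac}(G_1)|)\ \Big|\ [\mathrm{Jac}(G):S]^2\quad\text{and}\quad \gcd(|\mathrm{Jac}(G)|,|\mathrm{Jac}(G_1)|)\ \Big|\ [\mathrm{Jac}(G_1):S_1]^2.$$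
   Context: For a finite connected loopless multigraph $H$ with vertex set $V(H)$: a divisor is an element of $\mathbb{Z}^{V(H)}$; its degree is the sum of its values; $\mathrm{Div}^0(H)$ is the group of degree-zero divisors. The Laplacian is $L=\Delta-A$, where $\Delta$ is the diagonal matrix of vertex valencies and $A_{vw}$ is the number of edges between $v$ and $w$. Principal divisors are those of the form $L\sigma$ with $\sigma\in\mathbb{Z}^{V(H)}$, and $\mathrm{Jac}(H)=\mathrm{Div}^0(H)/\{L\sigma\}$, a finite abelian group whose order equals the number of spanning trees of $H$. For vertices $x\neq y$, $\delta_{xy}$ is the divisor with value $-1$ at $x$, $1$ at $y$ and $0$ elsewhere, and $[\delta_{xy}]$ is its class in the Jacobian. -}

module Defs where

open import Data.Nat using (ℕ; zero; suc) renaming (_+_ to _+ℕ_; _≤_ to _≤ℕ_)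
open import Data.Integer as ℤ using (ℤ; +_; -[1+_]; 0ℤ; 1ℤ; -1ℤ; _-_; _*_)
open import Data.Fin using (Fin; _≟_)
import Data.Fin as Fin
open import Data.Product using (Σ; ∃; _×_)
open import Data.Sum using (_⊎_)
open import Data.Bool using (Bool; true; false; if_then_else_; _∧_; _∨_)
open import Relation.Nullary.Decidable using (⌊_⌋)
open import Relation.Binary.PropositionalEquality using (_≡_)

-- A multigraph on vertex set Fin n is given by its adjacency function:
-- A v w = number of edges between v and w.
Adj : ℕ → Set
Adj n = Fin n → Fin n → ℕ

sumℤ : ∀ {n} → (Fin n → ℤ) → ℤ
sumℤ {zero}  f = 0ℤ
sumℤ {suc n} f = f Fin.zero ℤ.+ sumℤ {n} (λ i → f (Fin.suc i))

sumℕ : ∀ {n} → (Fin n → ℕ) → ℕ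
sumℕ {zero}  f = 0
sumℕ {suc n} f = f Fin.zero +ℕ sumℕ {n} (λ i → f (Fin.suc i))

Symmetric : ∀ {n} → Adj n → Set
Symmetric A = ∀ v w → A v w ≡ A w v

Loopless : ∀ {n} → Adj n → Set
Loopless A = ∀ v → A v v ≡ 0

data Reach {n} (A : Adj n) : Fin n → Fin n → Set where
  here : ∀ {v} → Reach A v v
  step : ∀ {u w v} → 1 ≤ℕ A u w → Reach A w v → Reach A u v

Connected : ∀ {n} → Adj n → Set
Connected A = ∀ u v → Reach A u v

IsMultigraph : ∀ {n} → Adj n → Set
IsMultigraph A = Symmetric A × Loopless A × Connected A

Div : ℕ → Set
Div n = Fin n → ℤ

deg : ∀ {n} → Div n → ℤ
deg D = sumℤ D

valency : ∀ {n} → Adj n → Fin n → ℕ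
valency A v = sumℕ (λ w → A v w)

lap : ∀ {n} → Adj n → (Fin n → ℤ) → Div n
lap A σ v = (+ valency A v) * σ v - sumℤ (λ w → (+ A v w) * σ w)

δ : ∀ {n} → Fin n → Fin n → Div n
δ x y v = if ⌊ v ≟ x ⌋ then -1ℤ else (if ⌊ v ≟ y ⌋ then 1ℤ else 0ℤ)

LinEq : ∀ {n} → Adj n → Div n → Div n → Set
LinEq A D D' = Σ (Fin _ → ℤ) λ σ → ∀ v → D v - D' v ≡ lap A σ v

-- equivalence modulo principal divisors and the subgroup generated by δ_xy
-- (i.e. equality of classes in Jac / S)
ModS : ∀ {n} → Adj n → Fin n → Fin n → Div n → Div n → Set
ModS A x y D D' = Σ (Fin _ → ℤ) λ σ → Σ ℤ λ m → ∀ v → D v - D' v ≡ lap A σ v ℤ.+ m * δ x y v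

-- "Div⁰ / R has exactly N elements": a complete irredundant system of
-- N representatives of degree-zero divisors modulo R.
QuotCard : ∀ {n} → (Div n → Div n → Set) → ℕ → Set
QuotCard {n} R N =
  Σ (Fin N → Div n) λ r →
    (∀ i → deg (r i) ≡ 0ℤ) ×
    (∀ i j → R (r i) (r j) → i ≡ j) ×
    (∀ D → deg D ≡ 0ℤ → ∃ λ i → R D (r i))

JacOrder : ∀ {n} → Adj n → ℕ → Set
JacOrder A N = QuotCard (LinEq A) N

JacIndex : ∀ {n} → Adj n → Fin n → Fin n → ℕ → Set
JacIndex A x y I = QuotCard (ModS A x y) I

isPair : ∀ {n} → Fin n → Fin n → Fin n → Fin n → Bool
isPair x y u v = (⌊ u ≟ x ⌋ ∧ ⌊ v ≟ y ⌋) ∨ (⌊ u ≟ y ⌋ ∧ ⌊ v ≟ x ⌋)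

-- A₁ is obtained from A by removing k edges between x and y (adding |k| if k<0).
-- Since A₁ is ℕ-valued, this forces A x y ≥ k when k ≥ 0.
Modified : ∀ {n} → Fin n → Fin n → ℤ → Adj n → Adj n → Set
Modified x y k A A₁ =
  ∀ u v → + A₁ u v ≡ (+ A u v) - (if isPair x y u v then k else 0ℤ)

-- Let o be the order of [δ_xy] in Jac(G), and write o·δ_xy = Lτ and t = τ(y) − τ(x). Lagrange gives
-- |Jac(G)| = I·o with I = [Jac(G) : S]. Changing the multiplicity of the edge xy by −k changes the
-- Laplacian to L₁σ = Lσ − k(σ(y) − σ(x))·δ_xy, so principal divisors plus ℤ·δ_xy form the same lattice
-- for G and G₁: hence I₁ = I, |Jac(G₁)| = I·o₁, and L₁τ = (o − kt)·δ_xy shows o₁ ∣ o − kt. So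
-- gcd(|Jac(G)|, |Jac(G₁)|) divides I·o and I·(o − kt), hence I·kt, hence (k being prime to
-- |Jac(G)|) I·gcd(o, t). Finally gcd(o, t) ∣ I: pairing I·(χ_v − χ_x) = Lσ + m·δ_xy with τ and using
-- the symmetry of L gives I·(τ(v) − τ(x)) = o·(σ(y) − σ(x)) + m·t for every vertex v, while the
-- minimality of o makes o coprime to the family of differences τ(v) − τ(x).

module Submission where

open import Defs
open import Data.Nat as ℕ using (ℕ; zero; suc; _<_; z<s; s<s; NonZero; _^_)
import Data.Nat.Properties as ℕ
open import Algebra.Properties.CommutativeSemigroup ℕ.*-commutativeSemigroup using (xy∙z≈xz∙y)
open import Data.Nat.Divisibility
  using (_∣_; divides; ∣-trans; ∣1⇒≡1; 0∣⇒≡0; *-monoʳ-∣; *-monoˡ-∣; *-cancelʳ-∣)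
open import Data.Nat.GCD
  using (gcd; gcd[m,n]∣m; gcd[m,n]∣n; gcd-greatest; gcd[m,n]≡0⇒m≡0; c*gcd[m,n]≡gcd[cm,cn])
open import Data.Nat.Coprimality using (Coprime; coprime-divisor)
open import Data.Integer as ℤ using (ℤ; +_; -[1+_]; 0ℤ; 1ℤ; -1ℤ; _+_; _-_; _*_; -_; ∣_∣)
import Data.Integer.Properties as ℤ
import Data.Integer.Divisibility.Signed as ℤ∣
open import Data.Integer.DivMod using (_%ℕ_; _/ℕ_; a≡a%ℕn+[a/ℕn]*n; n%ℕd<d)
open import Data.Integer.Tactic.RingSolver using (solve-∀)
open import Algebra.Properties.Ring ℤ.+-*-ring using ([y-z]x≈yx-zx; x[y-z]≈xy-xz)
import Algebra.Properties.Semiring.Sum ℤ.+-*-semiring as ∑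
open import Data.Fin using (Fin; zero; suc; _≟_; toℕ; fromℕ<; combine; remQuot)
import Data.Fin.Properties as Fin
open import Data.Fin.Permutation using (Permutation; _⟨$⟩ʳ_)
open import Data.Bool using (Bool; true; false; if_then_else_; _∧_; _∨_)
open import Data.Product using (Σ; ∃; ∃₂; _×_; _,_; proj₁; proj₂; uncurry)
open import Data.Product.Properties using (×-≡,≡→≡; ×-≡,≡←≡)
open import Data.Sum using (_⊎_; inj₁; inj₂)
open import Data.Empty using (⊥-elim)
open import Function using (_∘_; _⇔_; Equivalence; mk⇔; mk↔ₛ′)
import Function.Properties.Equivalence as ⇔
open import Relation.Nullary using (¬_; Dec; yes; no)
open import Relation.Nullary.Decidable using (⌊_⌋; _×-dec_)
open import Relation.Unary using (Decidable)
open import Relation.Binary.Definitions using (tri<; tri≈; tri>)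
open import Relation.Binary.PropositionalEquality
  using (_≡_; _≢_; _≗_; refl; sym; trans; cong; cong₂; subst; subst₂; module ≡-Reasoning)

-- Finite sums

sumℤ≡sum : ∀ {n} (f : Fin n → ℤ) → sumℤ f ≡ ∑.sum f
sumℤ≡sum {zero}  f = refl
sumℤ≡sum {suc n} f = cong (_+_ (f zero)) (sumℤ≡sum (f ∘ suc))

sumℤ-cong : ∀ {n} {f g : Fin n → ℤ} → f ≗ g → sumℤ f ≡ sumℤ g
sumℤ-cong {f = f} {g} f≗g =
  trans (sumℤ≡sum f) (trans (∑.sum-cong-≗ {x = f} {y = g} f≗g) (sym (sumℤ≡sum g)))

sumℤ-distrib-+ : ∀ {n} (f g : Fin n → ℤ) → sumℤ (λ i → f i + g i) ≡ sumℤ f + sumℤ g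
sumℤ-distrib-+ f g = trans (sumℤ≡sum (λ i → f i + g i))
  (trans (∑.∑-distrib-+ f g) (sym (cong₂ _+_ (sumℤ≡sum f) (sumℤ≡sum g))))

*-distribˡ-sumℤ : ∀ {n} (c : ℤ) (f : Fin n → ℤ) → sumℤ (λ i → c * f i) ≡ c * sumℤ f
*-distribˡ-sumℤ c f = trans (sumℤ≡sum (λ i → c * f i))
  (trans (sym (∑.*-distribˡ-sum c f)) (cong (c *_) (sym (sumℤ≡sum f))))

*-distribʳ-sumℤ : ∀ {n} (c : ℤ) (f : Fin n → ℤ) → sumℤ (λ i → f i * c) ≡ sumℤ f * c
*-distribʳ-sumℤ c f = trans (sumℤ≡sum (λ i → f i * c))
  (trans (sym (∑.*-distribʳ-sum c f)) (cong (_* c) (sym (sumℤ≡sum f))))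

sumℤ-distrib-minus : ∀ {n} (f g : Fin n → ℤ) → sumℤ (λ i → f i - g i) ≡ sumℤ f - sumℤ g
sumℤ-distrib-minus f g = begin
  sumℤ (λ i → f i - g i)            ≡⟨ sumℤ-cong (λ i → cong (_+_ (f i)) (sym (ℤ.-1*i≡-i (g i)))) ⟩
  sumℤ (λ i → f i + -1ℤ * g i)      ≡⟨ sumℤ-distrib-+ f _ ⟩
  sumℤ f + sumℤ (λ i → -1ℤ * g i)   ≡⟨ cong (_+_ (sumℤ f)) (trans (*-distribˡ-sumℤ -1ℤ g) (ℤ.-1*i≡-i _)) ⟩
  sumℤ f - sumℤ g                   ∎
  where open ≡-Reasoning

sumℤ-comm : ∀ {m n} (f : Fin m → Fin n → ℤ) →
            sumℤ (λ i → sumℤ (f i)) ≡ sumℤ (λ j → sumℤ (λ i → f i j))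
sumℤ-comm f = begin
  sumℤ (λ i → sumℤ (f i))           ≡⟨ sumℤ-cong (λ i → sumℤ≡sum (f i)) ⟩
  sumℤ (λ i → ∑.sum (f i))          ≡⟨ sumℤ≡sum (λ i → ∑.sum (f i)) ⟩
  ∑.sum (λ i → ∑.sum (f i))         ≡⟨ ∑.∑-comm f ⟩
  ∑.sum (λ j → ∑.sum (λ i → f i j)) ≡⟨ sym (sumℤ≡sum (λ j → ∑.sum (λ i → f i j))) ⟩
  sumℤ (λ j → ∑.sum (λ i → f i j))  ≡⟨ sumℤ-cong (λ j → sym (sumℤ≡sum (λ i → f i j))) ⟩
  sumℤ (λ j → sumℤ (λ i → f i j))   ∎
  where open ≡-Reasoning

sumℤ-permute : ∀ {n} (f : Fin n → ℤ) (π : Permutation n n) → sumℤ (f ∘ (π ⟨$⟩ʳ_)) ≡ sumℤ f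
sumℤ-permute f π =
  trans (sumℤ≡sum (f ∘ (π ⟨$⟩ʳ_))) (trans (sym (∑.sum-permute f π)) (sym (sumℤ≡sum f)))

sumℤ-const : ∀ n (c : ℤ) → sumℤ {n} (λ _ → c) ≡ + n * c
sumℤ-const zero    c = sym (ℤ.*-zeroˡ c)
sumℤ-const (suc n) c = trans (cong (_+_ c) (sumℤ-const n c)) (sym (ℤ.suc-* (+ n) c))

+sumℕ≡sumℤ : ∀ {n} (f : Fin n → ℕ) → + sumℕ f ≡ sumℤ (λ i → + f i)
+sumℕ≡sumℤ {zero}  f = refl
+sumℕ≡sumℤ {suc n} f =
  trans (ℤ.pos-+ (f zero) _) (cong (_+_ (+ f zero)) (+sumℕ≡sumℤ (f ∘ suc)))

-- Elementary arithmetic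

module _ {p} {P : ℕ → Set p} (P? : Decidable P) where

  Least : ℕ → Set p
  Least o = P o × (∀ {j} → j < o → ¬ P j)

  least-or-none-below : ∀ w → ∃ Least ⊎ (∀ {j} → j < w → ¬ P j)
  least-or-none-below zero = inj₂ λ ()
  least-or-none-below (suc w) with least-or-none-below w
  ... | inj₁ least = inj₁ least
  ... | inj₂ none with P? w
  ...   | yes Pw = inj₁ (w , Pw , none)
  ...   | no ¬Pw = inj₂ λ j<1+w → below-or-equal (ℕ.m≤n⇒m<n∨m≡n (ℕ.s≤s⁻¹ j<1+w))
    where
    below-or-equal : ∀ {j} → j < w ⊎ j ≡ w → ¬ P j
    below-or-equal (inj₁ j<w)  = none j<w
    below-or-equal (inj₂ refl) = ¬Pw

  least-witness : ∀ {w} → P w → ∃ Least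
  least-witness {w} Pw with least-or-none-below (suc w)
  ... | inj₁ least = least
  ... | inj₂ none  = ⊥-elim (none ℕ.≤-refl Pw)

card-by-injections : ∀ {a b c} {f : Fin b × Fin c → Fin a} {h : Fin a → Fin b × Fin c} →
                     (∀ {p q} → f p ≡ f q → p ≡ q) → (∀ {i j} → h i ≡ h j → i ≡ j) → a ≡ b ℕ.* c
card-by-injections {b = b} {c} {f} {h} f-inj h-inj = sym (Fin.cantor-schröder-bernstein
  {f = f ∘ remQuot c} {g = uncurry combine ∘ h}
  (λ {x} {y} eq → trans (sym (Fin.combine-remQuot {b} c x))
                        (trans (cong (uncurry combine) (f-inj eq)) (Fin.combine-remQuot {b} c y)))
  (λ eq → h-inj (×-≡,≡→≡ (Fin.combine-injective _ _ _ _ eq))))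

a≡r+[a/ℕn]*n : ∀ c {o} .{{_ : NonZero o}} {r} → c %ℕ o ≡ r → c ≡ + r + (c /ℕ o) * + o
a≡r+[a/ℕn]*n c {o} refl = a≡a%ℕn+[a/ℕn]*n c o

∣-cancel-coprime-family : ∀ {ι : Set} {d m} (a : ι → ℕ) → d ≢ 0 → (∀ i → d ∣ m ℕ.* a i) →
                          (∀ e → e ∣ d → (∀ i → e ∣ a i) → e ≡ 1) → d ∣ m
∣-cancel-coprime-family {d = d} {m} a d≢0 d∣ma only-1
  with gcd[m,n]∣m d m | gcd[m,n]∣n d m
... | divides d′ d≡d′G | divides m′ m≡m′G = subst (_∣ m) (sym d≡G) (gcd[m,n]∣n d m)
  where
  G = gcd d m
  instance
    G≢0 : NonZero G
    G≢0 = ℕ.≢-nonZero (d≢0 ∘ gcd[m,n]≡0⇒m≡0)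
  scaled : ∀ {c n n′} → n ≡ n′ ℕ.* G → c ∣ n′ → c ℕ.* G ∣ n
  scaled {c} n≡n′G c∣n′ = subst (c ℕ.* G ∣_) (sym n≡n′G) (*-monoˡ-∣ G c∣n′)
  d′m′-coprime : Coprime d′ m′
  d′m′-coprime {c} (c∣d′ , c∣m′) = ∣1⇒≡1 (*-cancelʳ-∣ G (subst (c ℕ.* G ∣_) (sym (ℕ.*-identityˡ G))
    (gcd-greatest (scaled d≡d′G c∣d′) (scaled m≡m′G c∣m′))))
  d′∣a : ∀ i → d′ ∣ a i
  d′∣a i = coprime-divisor d′m′-coprime (*-cancelʳ-∣ G
    (subst₂ _∣_ d≡d′G (trans (cong (ℕ._* a i) m≡m′G) (xy∙z≈xz∙y m′ G (a i))) (d∣ma i)))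
  d≡G : d ≡ G
  d≡G = trans d≡d′G (trans (cong (ℕ._* G) (only-1 d′ (divides G (trans d≡d′G (ℕ.*-comm d′ G))) d′∣a))
                           (ℕ.*-identityˡ G))

gcd∣index² : ∀ {N N₁ I o o₁} (k t : ℤ) → N ≡ I ℕ.* o → N₁ ≡ I ℕ.* o₁ → o₁ ∣ ∣ + o - k * t ∣ →
             gcd N ∣ k ∣ ≡ 1 → gcd o ∣ t ∣ ∣ I → gcd N N₁ ∣ I ^ 2
gcd∣index² {N} {N₁} {I} {o} {o₁} k t N≡Io N₁≡Io₁ o₁∣o-kt gcd[N,k]≡1 gcd[o,t]∣I =
  subst (G ∣_) (cong (I ℕ.*_) (sym (ℕ.*-identityʳ I)))
        (∣-trans (subst (G ∣_) (sym (c*gcd[m,n]≡gcd[cm,cn] I o ∣ t ∣)) (gcd-greatest G∣Io G∣I∣t∣))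
                 (*-monoʳ-∣ I gcd[o,t]∣I))
  where
  G = gcd N N₁
  G∣Io : G ∣ I ℕ.* o
  G∣Io = subst (G ∣_) N≡Io (gcd[m,n]∣m N N₁)
  G∣I[o-kt] : G ∣ ∣ + I * (+ o - k * t) ∣
  G∣I[o-kt] = subst (G ∣_) (sym (ℤ.abs-* (+ I) (+ o - k * t)))
                    (∣-trans (subst (G ∣_) N₁≡Io₁ (gcd[m,n]∣n N N₁)) (*-monoʳ-∣ I o₁∣o-kt))
  difference : ∀ I o k t → I * o - I * (o - k * t) ≡ k * (I * t)
  difference = solve-∀
  G∣kIt : G ∣ ∣ k ∣ ℕ.* (I ℕ.* ∣ t ∣)
  G∣kIt = subst (G ∣_) (trans (ℤ.abs-* k (+ I * t)) (cong (∣ k ∣ ℕ.*_) (ℤ.abs-* (+ I) t)))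
    (ℤ∣.∣⇒∣ᵤ {+ G} (subst (+ G ℤ∣.∣_) (difference (+ I) (+ o) k t)
      (ℤ∣.∣m∣n⇒∣m-n {+ G} {+ I * + o} {+ I * (+ o - k * t)}
        (ℤ∣.∣ᵤ⇒∣ (subst (G ∣_) (sym (ℤ.abs-* (+ I) (+ o))) G∣Io)) (ℤ∣.∣ᵤ⇒∣ G∣I[o-kt]))))
  G-k-coprime : Coprime G ∣ k ∣
  G-k-coprime (c∣G , c∣k) =
    ∣1⇒≡1 (subst (_ ∣_) gcd[N,k]≡1 (gcd-greatest (∣-trans c∣G (gcd[m,n]∣m N N₁)) c∣k))
  G∣I∣t∣ : G ∣ I ℕ.* ∣ t ∣
  G∣I∣t∣ = coprime-divisor G-k-coprime G∣kIt

-- Divisors and their pairing with functions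

⟦_⟧ : Bool → ℤ
⟦ b ⟧ = if b then 1ℤ else 0ℤ

χ : ∀ {n} → Fin n → Div n
χ w v = ⟦ ⌊ v ≟ w ⌋ ⟧

⟨_,_⟩ : ∀ {n} → Div n → (Fin n → ℤ) → ℤ
⟨ D , f ⟩ = sumℤ (λ v → D v * f v)

χ-subst : ∀ {n} (w v : Fin n) (f : Fin n → ℤ) → χ w v * f v ≡ χ w v * f w
χ-subst w v f with v ≟ w
... | yes refl = refl
... | no  _    = trans (ℤ.*-zeroˡ (f v)) (sym (ℤ.*-zeroˡ (f w)))

χ-suc : ∀ {n} (w v : Fin n) → χ (suc w) (suc v) ≡ χ w v
χ-suc w v with v ≟ w
... | yes _ = refl
... | no  _ = refl

⟨χ,⟩ : ∀ {n} (w : Fin n) (f : Fin n → ℤ) → ⟨ χ w , f ⟩ ≡ f w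
⟨χ,⟩ {suc n} zero f = begin
  1ℤ * f zero + sumℤ (λ v → 0ℤ * f (suc v))
    ≡⟨ cong₂ _+_ (ℤ.*-identityˡ (f zero)) (sumℤ-cong (λ v → ℤ.*-zeroˡ (f (suc v)))) ⟩
  f zero + sumℤ {n} (λ _ → 0ℤ)
    ≡⟨ cong (_+_ (f zero)) (trans (sumℤ-const n 0ℤ) (ℤ.*-zeroʳ (+ n))) ⟩
  f zero + 0ℤ
    ≡⟨ ℤ.+-identityʳ (f zero) ⟩
  f zero ∎
  where open ≡-Reasoning
⟨χ,⟩ {suc n} (suc w) f = begin
  0ℤ * f zero + sumℤ (λ v → χ (suc w) (suc v) * f (suc v))
    ≡⟨ cong₂ _+_ (ℤ.*-zeroˡ (f zero)) (sumℤ-cong (λ v → cong (_* f (suc v)) (χ-suc w v))) ⟩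
  0ℤ + ⟨ χ w , (λ v → f (suc v)) ⟩
    ≡⟨ ℤ.+-identityˡ _ ⟩
  ⟨ χ w , (λ v → f (suc v)) ⟩
    ≡⟨ ⟨χ,⟩ w (λ v → f (suc v)) ⟩
  f (suc w) ∎
  where open ≡-Reasoning

⟨-,⟩ : ∀ {n} (D E : Div n) (f : Fin n → ℤ) → ⟨ (λ v → D v - E v) , f ⟩ ≡ ⟨ D , f ⟩ - ⟨ E , f ⟩
⟨-,⟩ D E f = trans (sumℤ-cong (λ v → [y-z]x≈yx-zx (f v) (D v) (E v)))
                   (sumℤ-distrib-minus (λ v → D v * f v) (λ v → E v * f v))

⟨*,⟩ : ∀ {n} (c : ℤ) (D : Div n) (f : Fin n → ℤ) → ⟨ (λ v → c * D v) , f ⟩ ≡ c * ⟨ D , f ⟩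
⟨*,⟩ c D f = trans (sumℤ-cong (λ v → ℤ.*-assoc c (D v) (f v))) (*-distribˡ-sumℤ c (λ v → D v * f v))

deg≡⟨,1⟩ : ∀ {n} (D : Div n) → deg D ≡ ⟨ D , (λ _ → 1ℤ) ⟩
deg≡⟨,1⟩ D = sumℤ-cong (λ v → sym (ℤ.*-identityʳ (D v)))

⟨χ-χ,⟩ : ∀ {n} (a b : Fin n) (f : Fin n → ℤ) → ⟨ (λ v → χ b v - χ a v) , f ⟩ ≡ f b - f a
⟨χ-χ,⟩ a b f = trans (⟨-,⟩ (χ b) (χ a) f) (cong₂ _-_ (⟨χ,⟩ b f) (⟨χ,⟩ a f))

deg-χ-χ : ∀ {n} (a b : Fin n) → deg (λ v → χ b v - χ a v) ≡ 0ℤ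
deg-χ-χ a b = trans (deg≡⟨,1⟩ (λ v → χ b v - χ a v)) (trans (⟨χ-χ,⟩ a b (λ _ → 1ℤ)) (ℤ.+-inverseʳ 1ℤ))

module _ {n} {x y : Fin n} (x≢y : x ≢ y) where

  ≟-exclusive : ∀ v → ⌊ v ≟ x ⌋ ∧ ⌊ v ≟ y ⌋ ≡ false
  ≟-exclusive v with v ≟ x | v ≟ y
  ... | yes refl | yes refl = ⊥-elim (x≢y refl)
  ... | yes _    | no  _    = refl
  ... | no  _    | _        = refl

  δ≗χ-χ : ∀ v → δ x y v ≡ χ y v - χ x v
  δ≗χ-χ v = if-exclusive ⌊ v ≟ x ⌋ ⌊ v ≟ y ⌋ (≟-exclusive v)
    where
    if-exclusive : ∀ a c → a ∧ c ≡ false → (if a then -1ℤ else ⟦ c ⟧) ≡ ⟦ c ⟧ - ⟦ a ⟧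
    if-exclusive true  false _ = refl
    if-exclusive false true  _ = refl
    if-exclusive false false _ = refl

  ⟨δ,⟩ : ∀ f → ⟨ δ x y , f ⟩ ≡ f y - f x
  ⟨δ,⟩ f = trans (sumℤ-cong (λ v → cong (_* f v) (δ≗χ-χ v))) (⟨χ-χ,⟩ x y f)

  deg-δ : deg (δ x y) ≡ 0ℤ
  deg-δ = trans (sumℤ-cong δ≗χ-χ) (deg-χ-χ x y)

-- The Laplacian

module _ {n} (A : Adj n) where
  open ≡-Reasoning

  lap-sum-form : ∀ σ v → lap A σ v ≡ sumℤ (λ w → + A v w * (σ v - σ w))
  lap-sum-form σ v = begin
    + valency A v * σ v - sumℤ (λ w → + A v w * σ w)
      ≡⟨ cong (λ d → d * σ v - sumℤ (λ w → + A v w * σ w)) (+sumℕ≡sumℤ (A v)) ⟩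
    sumℤ (λ w → + A v w) * σ v - sumℤ (λ w → + A v w * σ w)
      ≡⟨ cong (_- sumℤ (λ w → + A v w * σ w)) (sym (*-distribʳ-sumℤ (σ v) (λ w → + A v w))) ⟩
    sumℤ (λ w → + A v w * σ v) - sumℤ (λ w → + A v w * σ w)
      ≡⟨ sym (sumℤ-distrib-minus (λ w → + A v w * σ v) (λ w → + A v w * σ w)) ⟩
    sumℤ (λ w → + A v w * σ v - + A v w * σ w)
      ≡⟨ sumℤ-cong (λ w → sym (x[y-z]≈xy-xz (+ A v w) (σ v) (σ w))) ⟩
    sumℤ (λ w → + A v w * (σ v - σ w)) ∎

  lap-cong : ∀ {σ τ} → σ ≗ τ → ∀ v → lap A σ v ≡ lap A τ v
  lap-cong σ≗τ v = cong₂ _-_ (cong (+ valency A v *_) (σ≗τ v))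
                             (sumℤ-cong (λ w → cong (+ A v w *_) (σ≗τ w)))

  lap-+ : ∀ σ τ v → lap A (λ w → σ w + τ w) v ≡ lap A σ v + lap A τ v
  lap-+ σ τ v = begin
    lap A (λ w → σ w + τ w) v
      ≡⟨ lap-sum-form (λ w → σ w + τ w) v ⟩
    sumℤ (λ w → + A v w * ((σ v + τ v) - (σ w + τ w)))
      ≡⟨ sumℤ-cong (λ w → split (+ A v w) (σ v) (τ v) (σ w) (τ w)) ⟩
    sumℤ (λ w → + A v w * (σ v - σ w) + + A v w * (τ v - τ w))
      ≡⟨ sumℤ-distrib-+ (λ w → + A v w * (σ v - σ w)) (λ w → + A v w * (τ v - τ w)) ⟩
    sumℤ (λ w → + A v w * (σ v - σ w)) + sumℤ (λ w → + A v w * (τ v - τ w))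
      ≡⟨ sym (cong₂ _+_ (lap-sum-form σ v) (lap-sum-form τ v)) ⟩
    lap A σ v + lap A τ v ∎
    where
    split : ∀ a s t s′ t′ → a * ((s + t) - (s′ + t′)) ≡ a * (s - s′) + a * (t - t′)
    split = solve-∀

  lap-* : ∀ c σ v → lap A (λ w → c * σ w) v ≡ c * lap A σ v
  lap-* c σ v = begin
    lap A (λ w → c * σ w) v
      ≡⟨ lap-sum-form (λ w → c * σ w) v ⟩
    sumℤ (λ w → + A v w * (c * σ v - c * σ w))
      ≡⟨ sumℤ-cong (λ w → pull (+ A v w) c (σ v) (σ w)) ⟩
    sumℤ (λ w → c * (+ A v w * (σ v - σ w)))
      ≡⟨ *-distribˡ-sumℤ c (λ w → + A v w * (σ v - σ w)) ⟩
    c * sumℤ (λ w → + A v w * (σ v - σ w))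
      ≡⟨ cong (c *_) (sym (lap-sum-form σ v)) ⟩
    c * lap A σ v ∎
    where
    pull : ∀ a c s s′ → a * (c * s - c * s′) ≡ c * (a * (s - s′))
    pull = solve-∀

  lap-const : ∀ c v → lap A (λ _ → c) v ≡ 0ℤ
  lap-const c v = begin
    lap A (λ _ → c) v                ≡⟨ lap-sum-form (λ _ → c) v ⟩
    sumℤ (λ w → + A v w * (c - c))   ≡⟨ sumℤ-cong (λ w → cong (+ A v w *_) (ℤ.+-inverseʳ c)) ⟩
    sumℤ (λ w → + A v w * 0ℤ)        ≡⟨ *-distribʳ-sumℤ 0ℤ (λ w → + A v w) ⟩
    sumℤ (λ w → + A v w) * 0ℤ        ≡⟨ ℤ.*-zeroʳ (sumℤ (λ w → + A v w)) ⟩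
    0ℤ                               ∎

  lap-self-adjoint : Symmetric A → ∀ σ τ → ⟨ lap A σ , τ ⟩ ≡ ⟨ σ , lap A τ ⟩
  lap-self-adjoint A-sym σ τ = begin
    ⟨ lap A σ , τ ⟩
      ≡⟨ sumℤ-cong (λ v → trans (cong (_* τ v) (lap-sum-form σ v))
                                (sym (*-distribʳ-sumℤ (τ v) (λ w → + A v w * (σ v - σ w))))) ⟩
    sumℤ (λ v → sumℤ (λ w → + A v w * (σ v - σ w) * τ v))
      ≡⟨ sumℤ-cong (λ v → sumℤ-cong (λ w → expandˡ (+ A v w) (σ v) (σ w) (τ v))) ⟩
    sumℤ (λ v → sumℤ (λ w → + A v w * (σ v * τ v) - + A v w * (σ w * τ v)))
      ≡⟨ sum²-distrib-minus (λ v w → + A v w * (σ v * τ v)) (λ v w → + A v w * (σ w * τ v)) ⟩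
    sumℤ (λ v → sumℤ (λ w → + A v w * (σ v * τ v))) - sumℤ (λ v → sumℤ (λ w → + A v w * (σ w * τ v)))
      ≡⟨ cong (_-_ (sumℤ (λ v → sumℤ (λ w → + A v w * (σ v * τ v))))) swap ⟩
    sumℤ (λ v → sumℤ (λ w → + A v w * (σ v * τ v))) - sumℤ (λ v → sumℤ (λ w → + A v w * (σ v * τ w)))
      ≡⟨ sum²-distrib-minus (λ v w → + A v w * (σ v * τ v)) (λ v w → + A v w * (σ v * τ w)) ⟨
    sumℤ (λ v → sumℤ (λ w → + A v w * (σ v * τ v) - + A v w * (σ v * τ w)))
      ≡⟨ sumℤ-cong (λ v → sumℤ-cong (λ w → expandʳ (+ A v w) (σ v) (τ v) (τ w))) ⟩
    sumℤ (λ v → sumℤ (λ w → σ v * (+ A v w * (τ v - τ w))))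
      ≡⟨ sumℤ-cong (λ v → trans (*-distribˡ-sumℤ (σ v) (λ w → + A v w * (τ v - τ w)))
                                (cong (σ v *_) (sym (lap-sum-form τ v)))) ⟩
    ⟨ σ , lap A τ ⟩ ∎
    where
    expandˡ : ∀ a s s′ t → a * (s - s′) * t ≡ a * (s * t) - a * (s′ * t)
    expandˡ = solve-∀
    expandʳ : ∀ a s t t′ → a * (s * t) - a * (s * t′) ≡ s * (a * (t - t′))
    expandʳ = solve-∀
    sum²-distrib-minus : ∀ (f g : Fin n → Fin n → ℤ) →
      sumℤ (λ v → sumℤ (λ w → f v w - g v w)) ≡ sumℤ (λ v → sumℤ (f v)) - sumℤ (λ v → sumℤ (g v))
    sum²-distrib-minus f g = trans (sumℤ-cong (λ v → sumℤ-distrib-minus (f v) (g v)))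
                               (sumℤ-distrib-minus (λ v → sumℤ (f v)) (λ v → sumℤ (g v)))
    swap : sumℤ (λ v → sumℤ (λ w → + A v w * (σ w * τ v)))
         ≡ sumℤ (λ v → sumℤ (λ w → + A v w * (σ v * τ w)))
    swap = trans (sumℤ-comm (λ v w → + A v w * (σ w * τ v)))
                 (sumℤ-cong (λ v → sumℤ-cong (λ w → cong (λ a → + a * (σ v * τ w)) (A-sym w v))))

module _ {n} {x y : Fin n} (x≢y : x ≢ y) where
  open ≡-Reasoning

  isPair-indicator : ∀ v w → ⟦ isPair x y v w ⟧ ≡ χ x v * χ y w + χ y v * χ x w
  isPair-indicator v w = ∨∧-indicator ⌊ v ≟ x ⌋ ⌊ w ≟ y ⌋ ⌊ v ≟ y ⌋ ⌊ w ≟ x ⌋ (≟-exclusive x≢y v)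
    where
    ∨∧-indicator : ∀ a b c d → a ∧ c ≡ false → ⟦ (a ∧ b) ∨ (c ∧ d) ⟧ ≡ ⟦ a ⟧ * ⟦ b ⟧ + ⟦ c ⟧ * ⟦ d ⟧
    ∨∧-indicator true  true  false true  _ = refl
    ∨∧-indicator true  true  false false _ = refl
    ∨∧-indicator true  false false true  _ = refl
    ∨∧-indicator true  false false false _ = refl
    ∨∧-indicator false true  true  true  _ = refl
    ∨∧-indicator false true  true  false _ = refl
    ∨∧-indicator false false true  true  _ = refl
    ∨∧-indicator false false true  false _ = refl
    ∨∧-indicator false true  false true  _ = refl
    ∨∧-indicator false true  false false _ = refl
    ∨∧-indicator false false false true  _ = refl
    ∨∧-indicator false false false false _ = refl

  edge-laplacian : ∀ (σ : Fin n → ℤ) v →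
                   sumℤ (λ w → ⟦ isPair x y v w ⟧ * (σ v - σ w)) ≡ (σ y - σ x) * δ x y v
  edge-laplacian σ v = begin
    sumℤ (λ w → ⟦ isPair x y v w ⟧ * (σ v - σ w))
      ≡⟨ sumℤ-cong (λ w → trans (cong (_* (σ v - σ w)) (isPair-indicator v w))
                                (split (χ x v) (χ y w) (χ y v) (χ x w) (σ v - σ w))) ⟩
    sumℤ (λ w → χ x v * (χ y w * (σ v - σ w)) + χ y v * (χ x w * (σ v - σ w)))
      ≡⟨ sumℤ-distrib-+ (λ w → χ x v * (χ y w * (σ v - σ w))) (λ w → χ y v * (χ x w * (σ v - σ w))) ⟩
    sumℤ (λ w → χ x v * (χ y w * (σ v - σ w))) + sumℤ (λ w → χ y v * (χ x w * (σ v - σ w)))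
      ≡⟨ cong₂ _+_ (*-distribˡ-sumℤ (χ x v) (λ w → χ y w * (σ v - σ w)))
                   (*-distribˡ-sumℤ (χ y v) (λ w → χ x w * (σ v - σ w))) ⟩
    χ x v * ⟨ χ y , (λ w → σ v - σ w) ⟩ + χ y v * ⟨ χ x , (λ w → σ v - σ w) ⟩
      ≡⟨ cong₂ (λ p q → χ x v * p + χ y v * q) (⟨χ,⟩ y (λ w → σ v - σ w)) (⟨χ,⟩ x (λ w → σ v - σ w)) ⟩
    χ x v * (σ v - σ y) + χ y v * (σ v - σ x)
      ≡⟨ cong₂ _+_ (χ-subst x v (λ u → σ u - σ y)) (χ-subst y v (λ u → σ u - σ x)) ⟩
    χ x v * (σ x - σ y) + χ y v * (σ y - σ x)
      ≡⟨ collect (χ x v) (χ y v) (σ x) (σ y) ⟩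
    (σ y - σ x) * (χ y v - χ x v)
      ≡⟨ cong (λ d → (σ y - σ x) * d) (δ≗χ-χ x≢y v) ⟨
    (σ y - σ x) * δ x y v ∎
    where
    split : ∀ a b c d e → (a * b + c * d) * e ≡ a * (b * e) + c * (d * e)
    split = solve-∀
    collect : ∀ a b s t → a * (s - t) + b * (t - s) ≡ (t - s) * (b - a)
    collect = solve-∀

  lap-modified : ∀ {k A A₁} → Modified x y k A A₁ →
                 ∀ (σ : Fin n → ℤ) v → lap A₁ σ v ≡ lap A σ v - k * ((σ y - σ x) * δ x y v)
  lap-modified {k} {A} {A₁} A₁≡A-k σ v = begin
    lap A₁ σ v
      ≡⟨ lap-sum-form A₁ σ v ⟩
    sumℤ (λ w → + A₁ v w * (σ v - σ w))
      ≡⟨ sumℤ-cong (λ w → cong (_* (σ v - σ w))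
                               (trans (A₁≡A-k v w) (cong (_-_ (+ A v w)) (if-k (isPair x y v w))))) ⟩
    sumℤ (λ w → (+ A v w - k * ⟦ isPair x y v w ⟧) * (σ v - σ w))
      ≡⟨ sumℤ-cong (λ w → split (+ A v w) k ⟦ isPair x y v w ⟧ (σ v - σ w)) ⟩
    sumℤ (λ w → + A v w * (σ v - σ w) - k * (⟦ isPair x y v w ⟧ * (σ v - σ w)))
      ≡⟨ sumℤ-distrib-minus (λ w → + A v w * (σ v - σ w)) (λ w → k * (⟦ isPair x y v w ⟧ * (σ v - σ w))) ⟩
    sumℤ (λ w → + A v w * (σ v - σ w)) - sumℤ (λ w → k * (⟦ isPair x y v w ⟧ * (σ v - σ w)))
      ≡⟨ cong₂ _-_ (sym (lap-sum-form A σ v))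
                   (trans (*-distribˡ-sumℤ k (λ w → ⟦ isPair x y v w ⟧ * (σ v - σ w)))
                          (cong (k *_) (edge-laplacian σ v))) ⟩
    lap A σ v - k * ((σ y - σ x) * δ x y v) ∎
    where
    if-k : ∀ b → (if b then k else 0ℤ) ≡ k * ⟦ b ⟧
    if-k true  = sym (ℤ.*-identityʳ k)
    if-k false = sym (ℤ.*-zeroʳ k)
    split : ∀ a k p d → (a - k * p) * d ≡ a * d - k * (p * d)
    split = solve-∀

-- Subgroups of divisors and their finite quotients

record Subgroup (n : ℕ) : Set₁ where
  field
    Member      : Div n → Set
    member-resp : ∀ {E E′} → E ≗ E′ → Member E → Member E′
    member-0    : Member (λ _ → 0ℤ)
    member-+    : ∀ {E E′} → Member E → Member E′ → Member (λ v → E v + E′ v)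
    member-neg  : ∀ {E} → Member E → Member (λ v → - E v)

  _∼_ : Div n → Div n → Set
  D ∼ D′ = Member (λ v → D v - D′ v)

  ∼-sym : ∀ D D′ → D ∼ D′ → D′ ∼ D
  ∼-sym D D′ = member-resp (λ v → negate (D v) (D′ v)) ∘ member-neg
    where
    negate : ∀ a b → - (a - b) ≡ b - a
    negate = solve-∀

  ∼-trans : ∀ D D′ D″ → D ∼ D′ → D′ ∼ D″ → D ∼ D″
  ∼-trans D D′ D″ p q = member-resp (λ v → telescope (D v) (D′ v) (D″ v)) (member-+ p q)
    where
    telescope : ∀ a b c → (a - b) + (b - c) ≡ a - c
    telescope = solve-∀

  member-minus : ∀ {E E′} → Member E → Member E′ → Member (λ v → E v - E′ v)
  member-minus p q = member-+ p (member-neg q)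

  member-ℕ* : ∀ j {E} → Member E → Member (λ v → + j * E v)
  member-ℕ* zero    {E} p = member-resp (λ v → sym (ℤ.*-zeroˡ (E v))) member-0
  member-ℕ* (suc j) {E} p =
    member-resp (λ v → trans (sym (ℤ.suc-* (+ j) (E v))) (cong (_* E v) (sym (ℤ.pos-+ 1 j))))
                (member-+ p (member-ℕ* j p))

  member-* : ∀ c {E} → Member E → Member (λ v → c * E v)
  member-* (+ j)     p = member-ℕ* j p
  member-* -[1+ j ] {E} p =
    member-resp (λ v → ℤ.neg-distribˡ-* (+ suc j) (E v)) (member-neg (member-ℕ* (suc j) p))

  member-sum : ∀ {a} (E : Fin a → Div n) → (∀ i → Member (E i)) → Member (λ v → sumℤ (λ i → E i v))
  member-sum {zero}  E p = member-0
  member-sum {suc a} E p = member-+ (p zero) (member-sum (E ∘ suc) (p ∘ suc))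

_+⟨_⟩ : ∀ {n} → Subgroup n → Div n → Subgroup n
S +⟨ g ⟩ = record
  { Member      = λ E → Σ ℤ λ m → S.Member (λ v → E v - m * g v)
  ; member-resp = λ E≗E′ (m , p) → m , S.member-resp (λ v → cong (_- m * g v) (E≗E′ v)) p
  ; member-0    = 0ℤ , S.member-resp (λ v → sym (zero-g (g v))) S.member-0
  ; member-+    = λ {E} {E′} (m , p) (m′ , p′) →
                    m + m′ , S.member-resp (λ v → add (E v) (E′ v) m m′ (g v)) (S.member-+ p p′)
  ; member-neg  = λ {E} (m , p) → - m , S.member-resp (λ v → neg (E v) m (g v)) (S.member-neg p)
  }
  where
  module S = Subgroup S
  zero-g : ∀ d → 0ℤ - 0ℤ * d ≡ 0ℤ
  zero-g = solve-∀
  add : ∀ e e′ m m′ d → (e - m * d) + (e′ - m′ * d) ≡ (e + e′) - (m + m′) * d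
  add = solve-∀
  neg : ∀ e m d → - (e - m * d) ≡ - e - (- m) * d
  neg = solve-∀

QuotCard-resp : ∀ {n} {R R′ : Div n → Div n → Set} {a} →
                (∀ {D D′} → R D D′ ⇔ R′ D D′) → QuotCard R a → QuotCard R′ a
QuotCard-resp R⇔R′ (r , r-deg , r-inj , r-cover) =
  r , r-deg , (λ i j → r-inj i j ∘ Equivalence.from R⇔R′) ,
  (λ D p → proj₁ (r-cover D p) , Equivalence.to R⇔R′ (proj₂ (r-cover D p)))

module FiniteQuotient {n} (S : Subgroup n) {a} (Q : QuotCard (Subgroup._∼_ S) a) where
  open Subgroup S

  r : Fin a → Div n
  r = proj₁ Q

  r-deg : ∀ i → deg (r i) ≡ 0ℤ
  r-deg = proj₁ (proj₂ Q)

  r-injective : ∀ i j → r i ∼ r j → i ≡ j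
  r-injective = proj₁ (proj₂ (proj₂ Q))

  class : (D : Div n) → deg D ≡ 0ℤ → Fin a
  class D p = proj₁ (proj₂ (proj₂ (proj₂ Q)) D p)

  class-∼ : ∀ D p → D ∼ r (class D p)
  class-∼ D p = proj₂ (proj₂ (proj₂ (proj₂ Q)) D p)

  class-unique : ∀ D p i → D ∼ r i → class D p ≡ i
  class-unique D p i D∼rᵢ =
    r-injective _ i (∼-trans (r (class D p)) D (r i) (∼-sym D _ (class-∼ D p)) D∼rᵢ)

  ∼⇒class≡ : ∀ D p D′ p′ → D ∼ D′ → class D p ≡ class D′ p′
  ∼⇒class≡ D p D′ p′ D∼D′ = class-unique D p _ (∼-trans D D′ (r (class D′ p′)) D∼D′ (class-∼ D′ p′))

  class≡⇒∼ : ∀ D p D′ p′ → class D p ≡ class D′ p′ → D ∼ D′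
  class≡⇒∼ D p D′ p′ eq = ∼-trans D (r (class D p)) D′ (class-∼ D p)
    (∼-sym D′ _ (subst (λ i → D′ ∼ r i) (sym eq) (class-∼ D′ p′)))

  deg-0 : deg {n} (λ _ → 0ℤ) ≡ 0ℤ
  deg-0 = trans (sumℤ-const n 0ℤ) (ℤ.*-zeroʳ (+ n))

  member? : ∀ E → deg E ≡ 0ℤ → Dec (Member E)
  member? E p with class E p Fin.≟ class (λ _ → 0ℤ) deg-0
  ... | yes eq = yes (member-resp (λ v → ℤ.+-identityʳ (E v)) (class≡⇒∼ E p (λ _ → 0ℤ) deg-0 eq))
  ... | no  ne = no (ne ∘ ∼⇒class≡ E p (λ _ → 0ℤ) deg-0 ∘ member-resp (λ v → sym (ℤ.+-identityʳ (E v))))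

  -- D ↦ class of r i + D permutes the classes, so the differences r i + D − r (π i) sum to a·D.
  exponent : ∀ D → deg D ≡ 0ℤ → Member (λ v → + a * D v)
  exponent D p = member-resp telescope
    (member-sum (λ i v → r i v + D v - r (π i) v) (λ i → class-∼ _ (shift-deg i)))
    where
    shift-deg : ∀ i → deg (λ v → r i v + D v) ≡ 0ℤ
    shift-deg i = trans (sumℤ-distrib-+ (r i) D) (cong₂ _+_ (r-deg i) p)
    unshift-deg : ∀ i → deg (λ v → r i v - D v) ≡ 0ℤ
    unshift-deg i = trans (sumℤ-distrib-minus (r i) D) (cong₂ _-_ (r-deg i) p)
    π π⁻¹ : Fin a → Fin a
    π   i = class (λ v → r i v + D v) (shift-deg i)
    π⁻¹ i = class (λ v → r i v - D v) (unshift-deg i)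
    swap : ∀ s d s′ → - (s - d - s′) ≡ s′ + d - s
    swap = solve-∀
    swap′ : ∀ s d s′ → - (s + d - s′) ≡ s′ - d - s
    swap′ = solve-∀
    π∘π⁻¹ : ∀ i → π (π⁻¹ i) ≡ i
    π∘π⁻¹ i = class-unique _ _ i (member-resp (λ v → swap (r i v) (D v) (r (π⁻¹ i) v))
                                          (member-neg (class-∼ _ (unshift-deg i))))
    π⁻¹∘π : ∀ i → π⁻¹ (π i) ≡ i
    π⁻¹∘π i = class-unique _ _ i (member-resp (λ v → swap′ (r i v) (D v) (r (π i) v))
                                          (member-neg (class-∼ _ (shift-deg i))))
    permutation : Permutation a a
    permutation = mk↔ₛ′ π π⁻¹ π∘π⁻¹ π⁻¹∘π
    telescope : ∀ v → sumℤ (λ i → r i v + D v - r (π i) v) ≡ + a * D v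
    telescope v = begin
      sumℤ (λ i → r i v + D v - r (π i) v)
        ≡⟨ sumℤ-distrib-minus (λ i → r i v + D v) (λ i → r (π i) v) ⟩
      sumℤ (λ i → r i v + D v) - sumℤ (λ i → r (π i) v)
        ≡⟨ cong₂ _-_ (sumℤ-distrib-+ (λ i → r i v) (λ _ → D v)) (sumℤ-permute (λ i → r i v) permutation) ⟩
      sumℤ (λ i → r i v) + sumℤ {a} (λ _ → D v) - sumℤ (λ i → r i v)
        ≡⟨ cancel (sumℤ (λ i → r i v)) (sumℤ {a} (λ _ → D v)) ⟩
      sumℤ {a} (λ _ → D v)
        ≡⟨ sumℤ-const a (D v) ⟩
      + a * D v ∎
      where
      open ≡-Reasoning
      cancel : ∀ s t → s + t - s ≡ t
      cancel = solve-∀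

QuotCard-unique : ∀ {n} (S : Subgroup n) {a b} →
                  QuotCard (Subgroup._∼_ S) a → QuotCard (Subgroup._∼_ S) b → a ≡ b
QuotCard-unique S Q Q′ = Fin.cantor-schröder-bernstein
  {f = λ i → Q′.class (Q.r i) (Q.r-deg i)} {g = λ j → Q.class (Q′.r j) (Q′.r-deg j)}
  (λ {i} {j} eq → Q.r-injective i j (Q′.class≡⇒∼ (Q.r i) (Q.r-deg i) (Q.r j) (Q.r-deg j) eq))
  (λ {i} {j} eq → Q′.r-injective i j (Q.class≡⇒∼ (Q′.r i) (Q′.r-deg i) (Q′.r j) (Q′.r-deg j) eq))
  where
  module Q  = FiniteQuotient S Q
  module Q′ = FiniteQuotient S Q′

-- The order of a class and Lagrange's index formula

module Order {n} (S : Subgroup n) (g : Div n) where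
  open Subgroup S

  Annihilates : ℤ → Set
  Annihilates c = Member (λ v → c * g v)

  record IsOrder (o : ℕ) : Set where
    field
      0<o         : 0 < o
      annihilates : Annihilates (+ o)
      minimal     : ∀ {j} → 0 < j → j < o → ¬ Annihilates (+ j)

  scale-deg : deg g ≡ 0ℤ → ∀ c → deg (λ v → c * g v) ≡ 0ℤ
  scale-deg g-deg c = trans (*-distribˡ-sumℤ c g) (trans (cong (c *_) g-deg) (ℤ.*-zeroʳ c))

  order-exists : deg g ≡ 0ℤ → ∀ {a} → QuotCard _∼_ a → ∃ IsOrder
  order-exists g-deg {a} Q = least⇒order (least-witness positive-annihilator? (0<a , exponent g g-deg))
    where
    open FiniteQuotient S Q
    positive-annihilator? : Decidable (λ j → 0 < j × Annihilates (+ j))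
    positive-annihilator? j = 0 ℕ.<? j ×-dec member? (λ v → + j * g v) (scale-deg g-deg (+ j))
    0<a : 0 < a
    0<a = ℕ.>-nonZero⁻¹ a {{Fin.nonZeroIndex (class g g-deg)}}
    least⇒order : ∃ (Least positive-annihilator?) → ∃ IsOrder
    least⇒order (o , (0<o , o-ann) , below) = o , record
      { 0<o = 0<o ; annihilates = o-ann ; minimal = λ 0<j j<o j-ann → below j<o (0<j , j-ann) }

  module _ {o} (o-order : IsOrder o) where
    open IsOrder o-order
    private instance
      o≢0 : NonZero o
      o≢0 = ℕ.>-nonZero 0<o

    order-∣ : ∀ c → Annihilates c → o ∣ ∣ c ∣
    order-∣ c c-ann with c %ℕ o in rem≡
    ... | zero = divides ∣ c /ℕ o ∣ (trans (cong ∣_∣ c≡q*o) (ℤ.abs-* (c /ℕ o) (+ o)))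
      where
      c≡q*o : c ≡ (c /ℕ o) * + o
      c≡q*o = trans (a≡r+[a/ℕn]*n c rem≡) (ℤ.+-identityˡ _)
    ... | suc r = ⊥-elim (minimal z<s (subst (_< o) rem≡ (n%ℕd<d c o))
                    (member-resp (λ v → cancel-quotient (+ suc r) (c /ℕ o) (+ o) (a≡r+[a/ℕn]*n c rem≡)
                                                        (g v))
                                 (member-minus c-ann (member-* (c /ℕ o) annihilates))))
      where
      cancel-quotient : ∀ {c} R q O → c ≡ R + q * O → ∀ d → c * d - q * (O * d) ≡ R * d
      cancel-quotient R q O refl d = identity R q O d
        where
        identity : ∀ R q O d → (R + q * O) * d - q * (O * d) ≡ R * d
        identity = solve-∀

    no-smaller-annihilator : ∀ {i k} → i < k → k < o → ¬ Annihilates (+ k - + i)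
    no-smaller-annihilator {i} {k} i<k k<o =
      minimal (ℕ.m<n⇒0<n∸m i<k) (ℕ.≤-<-trans (ℕ.m∸n≤m k i) k<o)
      ∘ member-resp (λ v → cong (_* g v) (trans (ℤ.m-n≡m⊖n k i) (ℤ.⊖-≥ (ℕ.<⇒≤ i<k))))

    annihilates-injective : ∀ (j j′ : Fin o) → Annihilates (+ toℕ j - + toℕ j′) → j ≡ j′
    annihilates-injective j j′ ann with ℕ.<-cmp (toℕ j) (toℕ j′)
    ... | tri≈ _ j≡j′ _ = Fin.toℕ-injective j≡j′
    ... | tri< j<j′ _ _ = ⊥-elim (no-smaller-annihilator j<j′ (Fin.toℕ<n j′)
                            (member-resp (λ v → negate (+ toℕ j) (+ toℕ j′) (g v)) (member-neg ann)))
      where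
      negate : ∀ a b d → - ((a - b) * d) ≡ (b - a) * d
      negate = solve-∀
    ... | tri> _ _ j′<j = ⊥-elim (no-smaller-annihilator j′<j (Fin.toℕ<n j) ann)

  module _ (g-deg : deg g ≡ 0ℤ) {a b o} (Q : QuotCard _∼_ a) (Q′ : QuotCard (Subgroup._∼_ (S +⟨ g ⟩)) b)
           (o-order : IsOrder o) where
    open IsOrder o-order
    private instance
      o≢0 : NonZero o
      o≢0 = ℕ.>-nonZero 0<o
    private
      module Q  = FiniteQuotient S Q
      module Q′ = FiniteQuotient (S +⟨ g ⟩) Q′

    coset-deg : ∀ i (j : ℕ) → deg (λ v → Q′.r i v + + j * g v) ≡ 0ℤ
    coset-deg i j = trans (sumℤ-distrib-+ (Q′.r i) (λ v → + j * g v))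
                          (trans (cong₂ _+_ (Q′.r-deg i) (scale-deg g-deg (+ j))) (ℤ.+-identityʳ 0ℤ))

    coset : Fin b × Fin o → Fin a
    coset (i , j) = Q.class (λ v → Q′.r i v + + toℕ j * g v) (coset-deg i (toℕ j))

    coset-injective : ∀ {p q} → coset p ≡ coset q → p ≡ q
    coset-injective {i , j} {i′ , j′} eq = ×-≡,≡→≡ (i≡i′ , j≡j′)
      where
      J J′ : ℤ
      J  = + toℕ j
      J′ = + toℕ j′
      related : Member (λ v → (Q′.r i v + J * g v) - (Q′.r i′ v + J′ * g v))
      related = Q.class≡⇒∼ _ (coset-deg i (toℕ j)) _ (coset-deg i′ (toℕ j′)) eq
      regroup : ∀ e e′ J J′ d → (e + J * d) - (e′ + J′ * d) ≡ (e - e′) - (J′ - J) * d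
      regroup = solve-∀
      i≡i′ : i ≡ i′
      i≡i′ = Q′.r-injective i i′
        (J′ - J , member-resp (λ v → regroup (Q′.r i v) (Q′.r i′ v) J J′ (g v)) related)
      difference : ∀ e J J′ d → (e + J * d) - (e + J′ * d) ≡ (J - J′) * d
      difference = solve-∀
      j≡j′ : j ≡ j′
      j≡j′ = annihilates-injective o-order j j′ (member-resp (λ v → difference (Q′.r i v) J J′ (g v))
               (subst (λ i′ → Member (λ v → (Q′.r i v + J * g v) - (Q′.r i′ v + J′ * g v))) (sym i≡i′) related))

    -- l ↦ (the class c of r l modulo S + ℤg, and m mod o where r l − r′ c − m·g ∈ S).
    coset-of : Fin a → Fin b × Fin o
    coset-of l = Q′.class (Q.r l) (Q.r-deg l) , fromℕ< (n%ℕd<d (proj₁ (Q′.class-∼ (Q.r l) (Q.r-deg l))) o)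

    coset-of-injective : ∀ {l l′} → coset-of l ≡ coset-of l′ → l ≡ l′
    coset-of-injective {l} {l′} eq = Q.r-injective l l′
      (member-resp (λ v → telescope (Q.r l v) (Q.r l′ v) (Q′.r c v) (+ (m %ℕ o)) q q′ (+ o) (g v) m≡ m′≡)
                   (member-+ (member-minus l-coset l′-coset) (member-* (q - q′) annihilates)))
      where
      c = Q′.class (Q.r l) (Q.r-deg l)
      c≡c′ : c ≡ Q′.class (Q.r l′) (Q.r-deg l′)
      c≡c′ = proj₁ (×-≡,≡←≡ eq)
      m m′ q q′ : ℤ
      m  = proj₁ (Q′.class-∼ (Q.r l) (Q.r-deg l))
      m′ = proj₁ (Q′.class-∼ (Q.r l′) (Q.r-deg l′))
      q  = m /ℕ o
      q′ = m′ /ℕ o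
      l-coset : Member (λ v → Q.r l v - Q′.r c v - m * g v)
      l-coset = proj₂ (Q′.class-∼ (Q.r l) (Q.r-deg l))
      l′-coset : Member (λ v → Q.r l′ v - Q′.r c v - m′ * g v)
      l′-coset = subst (λ c → Member (λ v → Q.r l′ v - Q′.r c v - m′ * g v)) (sym c≡c′)
                       (proj₂ (Q′.class-∼ (Q.r l′) (Q.r-deg l′)))
      same-remainder : m %ℕ o ≡ m′ %ℕ o
      same-remainder = trans (sym (Fin.toℕ-fromℕ< (n%ℕd<d m o)))
                             (trans (cong toℕ (proj₂ (×-≡,≡←≡ eq))) (Fin.toℕ-fromℕ< (n%ℕd<d m′ o)))
      m≡ : m ≡ + (m %ℕ o) + q * + o
      m≡ = a≡r+[a/ℕn]*n m refl
      m′≡ : m′ ≡ + (m %ℕ o) + q′ * + o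
      m′≡ = a≡r+[a/ℕn]*n m′ (sym same-remainder)
      telescope : ∀ {m m′} e e′ c R q q′ O d → m ≡ R + q * O → m′ ≡ R + q′ * O →
                  (e - c - m * d) - (e′ - c - m′ * d) + (q - q′) * (O * d) ≡ e - e′
      telescope e e′ c R q q′ O d refl refl = identity e e′ c R q q′ O d
        where
        identity : ∀ e e′ c R q q′ O d →
                   (e - c - (R + q * O) * d) - (e′ - c - (R + q′ * O) * d) + (q - q′) * (O * d) ≡ e - e′
        identity = solve-∀

    index-formula : a ≡ b ℕ.* o
    index-formula = card-by-injections coset-injective coset-of-injective

-- Jacobians of G and of the modified graph

principal : ∀ {n} → Adj n → Subgroup n
principal {n} A = record
  { Member      = λ E → Σ (Fin n → ℤ) λ σ → ∀ v → E v ≡ lap A σ v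
  ; member-resp = λ E≗E′ (σ , E≡Lσ) → σ , (λ v → trans (sym (E≗E′ v)) (E≡Lσ v))
  ; member-0    = (λ _ → 0ℤ) , (λ v → sym (lap-const A 0ℤ v))
  ; member-+    = λ (σ , p) (τ , q) → (λ w → σ w + τ w) ,
                    (λ v → trans (cong₂ _+_ (p v) (q v)) (sym (lap-+ A σ τ v)))
  ; member-neg  = λ (σ , p) → (λ w → -1ℤ * σ w) ,
                    (λ v → trans (cong -_ (p v)) (trans (sym (ℤ.-1*i≡-i _)) (sym (lap-* A -1ℤ σ v))))
  }

module _ {n} (A : Adj n) (x y : Fin n) where

  ModS⇔∼ : ∀ {D D′} → ModS A x y D D′ ⇔ Subgroup._∼_ (principal A +⟨ δ x y ⟩) D D′
  ModS⇔∼ {D} {D′} = mk⇔ (λ (σ , m , p) → m , σ , (λ v → move-left (lap A σ v) m (δ x y v) (p v)))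
                       (λ (m , σ , p) → σ , m , (λ v → move-right (D v - D′ v) m (δ x y v) (p v)))
    where
    move-left : ∀ {e} l m d → e ≡ l + m * d → e - m * d ≡ l
    move-left l m d refl = cancel l m d
      where
      cancel : ∀ l m d → l + m * d - m * d ≡ l
      cancel = solve-∀
    move-right : ∀ e m d {l} → e - m * d ≡ l → e ≡ l + m * d
    move-right e m d refl = restore e m d
      where
      restore : ∀ e m d → e ≡ e - m * d + m * d
      restore = solve-∀

  JacIndex⇒QuotCard : ∀ {I} → JacIndex A x y I → QuotCard (Subgroup._∼_ (principal A +⟨ δ x y ⟩)) I
  JacIndex⇒QuotCard = QuotCard-resp {R = ModS A x y} {R′ = Subgroup._∼_ (principal A +⟨ δ x y ⟩)}
                                    (λ {D} {D′} → ModS⇔∼ {D} {D′})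

module _ {n} {x y : Fin n} (x≢y : x ≢ y) {k A A₁} (A₁≡A-k : Modified x y k A A₁) where

  extended-principal-invariant : ∀ {E} → Subgroup.Member (principal A +⟨ δ x y ⟩) E
                                       ⇔ Subgroup.Member (principal A₁ +⟨ δ x y ⟩) E
  extended-principal-invariant {E} = mk⇔
    (λ (m , σ , p) → m + k * (σ y - σ x) , σ , λ v →
       trans (shift (E v) m k (σ y - σ x) (δ x y v)) (trans (cong (_- k * ((σ y - σ x) * δ x y v)) (p v))
             (sym (lap-modified x≢y A₁≡A-k σ v))))
    (λ (m , σ , p) → m - k * (σ y - σ x) , σ , λ v →
       trans (unshift (E v) m k (σ y - σ x) (δ x y v))
             (trans (cong (_+ k * ((σ y - σ x) * δ x y v)) (trans (p v) (lap-modified x≢y A₁≡A-k σ v)))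
                    (cancel (lap A σ v) (k * ((σ y - σ x) * δ x y v)))))
    where
    shift : ∀ e m k t d → e - (m + k * t) * d ≡ (e - m * d) - k * (t * d)
    shift = solve-∀
    unshift : ∀ e m k t d → e - (m - k * t) * d ≡ (e - m * d) + k * (t * d)
    unshift = solve-∀
    cancel : ∀ a b → a - b + b ≡ a
    cancel = solve-∀

  index-invariant : ∀ {I I₁} → JacIndex A x y I → JacIndex A₁ x y I₁ → I ≡ I₁
  index-invariant JI JI₁ = QuotCard-unique (principal A +⟨ δ x y ⟩) (JacIndex⇒QuotCard A x y JI)
    (QuotCard-resp (λ {D} {D′} → ⇔.sym (extended-principal-invariant {λ v → D v - D′ v}))
                   (JacIndex⇒QuotCard A₁ x y JI₁))

module _ {n} {A : Adj n} {g : Div n} {o} (o-order : Order.IsOrder (principal A) g o)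
         {τ : Fin n → ℤ} (og≡Lτ : ∀ v → + o * g v ≡ lap A τ v) (x : Fin n) where
  open Order.IsOrder o-order

  -- If e > 1 divided o and every τ v − τ x, then τ = τ x + e·b and (o/e)·g = L b, contradicting
  -- the minimality of o.
  potential-differences-coprime : ∀ e → e ∣ o → (∀ v → e ∣ ∣ τ v - τ x ∣) → e ≡ 1
  potential-differences-coprime zero 0∣o _ = ⊥-elim (ℕ.<-irrefl (sym (0∣⇒≡0 0∣o)) 0<o)
  potential-differences-coprime (suc zero) _ _ = refl
  potential-differences-coprime e@(suc (suc _)) (divides o′ o≡o′e) e∣τ =
    ⊥-elim (minimal 0<o′ o′<o (b , o′g≡Lb))
    where
    open ≡-Reasoning
    e∣τᵥ-τₓ : ∀ v → + e ℤ∣.∣ τ v - τ x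
    e∣τᵥ-τₓ v = ℤ∣.∣ᵤ⇒∣ {+ e} {τ v - τ x} (e∣τ v)
    b : Fin n → ℤ
    b v = ℤ∣.quotient (e∣τᵥ-τₓ v)
    τ≡τx+eb : ∀ v → τ v ≡ τ x + + e * b v
    τ≡τx+eb v = trans (sym (recentre (τ x) (τ v)))
                      (cong (_+_ (τ x)) (trans (ℤ∣._∣_.equality (e∣τᵥ-τₓ v)) (ℤ.*-comm (b v) (+ e))))
      where
      recentre : ∀ a c → a + (c - a) ≡ c
      recentre = solve-∀
    0<o′ : 0 < o′
    0<o′ = ℕ.n≢0⇒n>0 (λ { refl → ℕ.<-irrefl (sym o≡o′e) 0<o })
    o′<o : o′ < o
    o′<o = subst (o′ <_) (sym o≡o′e) (ℕ.m<m*n o′ e {{ℕ.>-nonZero 0<o′}} (s<s z<s))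
    o′g≡Lb : ∀ v → + o′ * g v ≡ lap A b v
    o′g≡Lb v = ℤ.*-cancelˡ-≡ (+ e) (+ o′ * g v) (lap A b v) (begin
      + e * (+ o′ * g v)                       ≡⟨ reassoc (+ e) (+ o′) (g v) ⟩
      (+ o′ * + e) * g v                       ≡⟨ cong (_* g v) (trans (sym (ℤ.pos-* o′ e)) (cong +_ (sym o≡o′e))) ⟩
      + o * g v                                ≡⟨ og≡Lτ v ⟩
      lap A τ v                                ≡⟨ lap-cong A τ≡τx+eb v ⟩
      lap A (λ w → τ x + + e * b w) v          ≡⟨ lap-+ A (λ _ → τ x) (λ w → + e * b w) v ⟩
      lap A (λ _ → τ x) v + lap A (λ w → + e * b w) v ≡⟨ cong₂ _+_ (lap-const A (τ x) v) (lap-* A (+ e) b v) ⟩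
      0ℤ + + e * lap A b v                     ≡⟨ ℤ.+-identityˡ _ ⟩
      + e * lap A b v                          ∎)
      where
      reassoc : ∀ e o d → e * (o * d) ≡ (o * e) * d
      reassoc = solve-∀

module _ {n} {A : Adj n} (A-sym : Symmetric A) {x y : Fin n} (x≢y : x ≢ y)
         {o} (o-order : Order.IsOrder (principal A) (δ x y) o)
         {τ : Fin n → ℤ} (oδ≡Lτ : ∀ v → + o * δ x y v ≡ lap A τ v)
         {I} (JI : QuotCard (Subgroup._∼_ (principal A +⟨ δ x y ⟩)) I) where

  index-times-potential : ∀ v → ∃₂ λ s m → + I * (τ v - τ x) ≡ + o * s + m * (τ y - τ x)
  index-times-potential v = σ y - σ x , m , move (begin
    + I * (τ v - τ x) - m * (τ y - τ x)
      ≡⟨ cong₂ (λ a b → + I * a - m * b) (⟨χ-χ,⟩ x v τ) (⟨δ,⟩ x≢y τ) ⟨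
    + I * ⟨ D , τ ⟩ - m * ⟨ δ x y , τ ⟩
      ≡⟨ cong₂ _-_ (⟨*,⟩ (+ I) D τ) (⟨*,⟩ m (δ x y) τ) ⟨
    ⟨ (λ u → + I * D u) , τ ⟩ - ⟨ (λ u → m * δ x y u) , τ ⟩
      ≡⟨ ⟨-,⟩ (λ u → + I * D u) (λ u → m * δ x y u) τ ⟨
    ⟨ (λ u → + I * D u - m * δ x y u) , τ ⟩
      ≡⟨ sumℤ-cong (λ u → cong (_* τ u) (ID-mδ≡Lσ u)) ⟩
    ⟨ lap A σ , τ ⟩
      ≡⟨ lap-self-adjoint A A-sym σ τ ⟩
    ⟨ σ , lap A τ ⟩
      ≡⟨ sumℤ-cong (λ u → trans (cong (σ u *_) (sym (oδ≡Lτ u))) (ℤ.*-comm (σ u) (+ o * δ x y u))) ⟩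
    ⟨ (λ u → + o * δ x y u) , σ ⟩
      ≡⟨ ⟨*,⟩ (+ o) (δ x y) σ ⟩
    + o * ⟨ δ x y , σ ⟩
      ≡⟨ cong (+ o *_) (⟨δ,⟩ x≢y σ) ⟩
    + o * (σ y - σ x) ∎)
    where
    open ≡-Reasoning
    D : Div n
    D u = χ v u - χ x u
    I·D∈Γ = FiniteQuotient.exponent (principal A +⟨ δ x y ⟩) JI D (deg-χ-χ x v)
    m = proj₁ I·D∈Γ
    σ = proj₁ (proj₂ I·D∈Γ)
    ID-mδ≡Lσ = proj₂ (proj₂ I·D∈Γ)
    move : ∀ {a b c} → a - b ≡ c → a ≡ c + b
    move {a} {b} refl = sym (cancel a b)
      where
      cancel : ∀ a b → a - b + b ≡ a
      cancel = solve-∀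

  gcd∣index : gcd o ∣ τ y - τ x ∣ ∣ I
  gcd∣index = ∣-cancel-coprime-family (λ v → ∣ τ v - τ x ∣) d≢0 d∣I·difference
    (λ e e∣d → potential-differences-coprime o-order oδ≡Lτ x e (∣-trans e∣d (gcd[m,n]∣m o ∣ t ∣)))
    where
    open Order.IsOrder o-order
    t = τ y - τ x
    d = gcd o ∣ t ∣
    d≢0 : d ≢ 0
    d≢0 d≡0 = ℕ.<-irrefl (sym (gcd[m,n]≡0⇒m≡0 d≡0)) 0<o
    d∣I·difference : ∀ v → d ∣ I ℕ.* ∣ τ v - τ x ∣
    d∣I·difference v = divides-combination (index-times-potential v)
      where
      divides-combination : ∃₂ (λ s m → + I * (τ v - τ x) ≡ + o * s + m * t) → d ∣ I ℕ.* ∣ τ v - τ x ∣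
      divides-combination (s , m , I[τv-τx]≡os+mt) =
        subst (d ∣_) (trans (cong ∣_∣ (sym I[τv-τx]≡os+mt)) (ℤ.abs-* (+ I) (τ v - τ x)))
          (ℤ∣.∣⇒∣ᵤ {+ d} {+ o * s + m * t} (ℤ∣.∣m∣n⇒∣m+n {+ d} {+ o * s} {m * t}
            (ℤ∣.∣m⇒∣m*n {+ d} {+ o} s (ℤ∣.∣ᵤ⇒∣ {+ d} {+ o} (gcd[m,n]∣m o ∣ t ∣)))
            (ℤ∣.∣n⇒∣m*n {+ d} m {t} (ℤ∣.∣ᵤ⇒∣ {+ d} {t} (gcd[m,n]∣n o ∣ t ∣)))))

modified-annihilates : ∀ {n} {x y : Fin n} → x ≢ y → ∀ {k A A₁} → Modified x y k A A₁ →
  ∀ {o τ} → (∀ v → + o * δ x y v ≡ lap A τ v) →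
  Order.Annihilates (principal A₁) (δ x y) (+ o - k * (τ y - τ x))
modified-annihilates {x = x} {y} x≢y {k} A₁≡A-k {o} {τ} oδ≡Lτ = τ , λ v →
  trans (spread (+ o) k (τ y - τ x) (δ x y v))
        (trans (cong (_- k * ((τ y - τ x) * δ x y v)) (oδ≡Lτ v)) (sym (lap-modified x≢y A₁≡A-k τ v)))
  where
  spread : ∀ o k t d → (o - k * t) * d ≡ o * d - k * (t * d)
  spread = solve-∀

theorem3p5 : ∀ {n} (A A₁ : Adj n) (x y : Fin n) (k : ℤ)
    (N N₁ I I₁ : ℕ) →
    IsMultigraph A → x ≢ y →
    JacOrder A N → gcd N ∣ k ∣ ≡ 1 →
    Modified x y k A A₁ → Connected A₁ →
    JacOrder A₁ N₁ → JacIndex A x y I → JacIndex A₁ x y I₁ →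
    (gcd N N₁ ∣ I ^ 2) × (gcd N N₁ ∣ I₁ ^ 2)
theorem3p5 A A₁ x y k N N₁ I I₁ (A-sym , _ , _) x≢y JA gcd[N,k]≡1 A₁≡A-k _ JA₁ JI JI₁ =
  gcd∣I² , subst (λ i → gcd N N₁ ∣ i ^ 2) I≡I₁ gcd∣I²
  where
  I≡I₁ : I ≡ I₁
  I≡I₁ = index-invariant x≢y A₁≡A-k JI JI₁
  module Λ  = Order (principal A)  (δ x y)
  module Λ₁ = Order (principal A₁) (δ x y)
  o  = proj₁ (Λ.order-exists  (deg-δ x≢y) JA)
  o₁ = proj₁ (Λ₁.order-exists (deg-δ x≢y) JA₁)
  o-order  = proj₂ (Λ.order-exists  (deg-δ x≢y) JA)
  o₁-order = proj₂ (Λ₁.order-exists (deg-δ x≢y) JA₁)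
  τ = proj₁ (Λ.IsOrder.annihilates o-order)
  oδ≡Lτ = proj₂ (Λ.IsOrder.annihilates o-order)
  N≡Io : N ≡ I ℕ.* o
  N≡Io = Λ.index-formula (deg-δ x≢y) JA (JacIndex⇒QuotCard A x y JI) o-order
  N₁≡Io₁ : N₁ ≡ I ℕ.* o₁
  N₁≡Io₁ = trans (Λ₁.index-formula (deg-δ x≢y) JA₁ (JacIndex⇒QuotCard A₁ x y JI₁) o₁-order)
                 (cong (ℕ._* o₁) (sym I≡I₁))
  gcd∣I² : gcd N N₁ ∣ I ^ 2
  gcd∣I² = gcd∣index² k (τ y - τ x) N≡Io N₁≡Io₁
    (Λ₁.order-∣ o₁-order (+ o - k * (τ y - τ x)) (modified-annihilates x≢y A₁≡A-k oδ≡Lτ)) gcd[N,k]≡1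
    (gcd∣index A-sym x≢y o-order oδ≡Lτ (JacIndex⇒QuotCard A x y JI))
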